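{- Let $$A_0=\begin{pmatrix}1&0&1\\0&1&1\\0&0&1\end{pmatrix},\quad A_1=\begin{pmatrix}0&0&1\\1&0&1\\0&1&1\end{pmatrix},\quad A_2=\begin{pmatrix}0&1&1\\0&0&1\\1&0&1\end{pmatrix},$$ let $P(x)=A_0+xA_1+x^2A_2$, let $V$ be the $3\times 3$ matrix whose columns are $v_1=(0,0,1)^T$, $v_2=(1,0,1)^T$, $v_3=(1,1,1)^T$, let $e_1,e_2,e_3$ be the standard basis column vectors of $\mathbb{R}^3$, and let $\mathrm{Id}_3$ be the $3\times 3$ identity matrix. Let $(a_N)_{N\ge 1}$ be Stern's triatomic sequence (defined in the context). Then, as formal power series in $x$, $$\sum_{N\ge 1} a_N x^N = e_3^T\, V\left[\mathrm{Id}_3+\sum_{k=1}^{\infty} x^{\frac{3(3^k-1)}{2}}\, P\!\left(x^{3^k}\right)P\!\left(x^{3^{k-1}}\right)\cdots P\!\left(x^{3}\right)\right]\left(x e_1+x^2e_2+x^3e_3\right).$$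
   Context: For a finite tuple $I=(i_1,\dots,i_n)$ with each $i_j\in\{0,1,2\}$ (the empty tuple, $n=0$, allowed), define the row vector $(v_1(I),v_2(I),v_3(I))=(1,1,1)A_{i_1}A_{i_2}\cdots A_{i_n}$, with $A_0,A_1,A_2$ as in the claim. Stern's triatomic sequence $(a_N)_{N\ge1}$ is defined by $a_N=v_k(I)$ where $N=\frac{3(3^n-1)}{2}+i_1 3^n+i_2 3^{n-1}+\cdots+i_n 3+k$ with $k\in\{1,2,3\}$; every positive integer $N$ arises from exactly one pair $(I,k)$. (Equivalently, the sequence lists the triples $(v_1(I),v_2(I),v_3(I))$ in order of increasing length of $I$, and lexicographically among tuples of equal length.) In particular $a_1=a_2=a_3=1$. -}

module Defs where

open import Data.Nat using (ℕ; zero; suc; _+_; _*_; _∸_; _^_; _≤_; _≟_)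
open import Data.Nat.DivMod using (_/_)
open import Data.Fin using (Fin; toℕ) renaming (zero to f0; suc to fs)
open import Data.List using (List; []; _∷_; length; foldl)
open import Data.Vec using (Vec; []; _∷_; lookup)
open import Data.Product using (∃; _×_)
open import Relation.Binary.PropositionalEquality using (_≡_)
open import Relation.Nullary using (yes; no)

NMat : Set
NMat = Fin 3 → Fin 3 → ℕ

fromRows : Vec (Vec ℕ 3) 3 → NMat
fromRows rs i j = lookup (lookup rs i) j

A₀ A₁ A₂ : NMat
A₀ = fromRows ((1 ∷ 0 ∷ 1 ∷ []) ∷ (0 ∷ 1 ∷ 1 ∷ []) ∷ (0 ∷ 0 ∷ 1 ∷ []) ∷ [])
A₁ = fromRows ((0 ∷ 0 ∷ 1 ∷ []) ∷ (1 ∷ 0 ∷ 1 ∷ []) ∷ (0 ∷ 1 ∷ 1 ∷ []) ∷ [])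
A₂ = fromRows ((0 ∷ 1 ∷ 1 ∷ []) ∷ (0 ∷ 0 ∷ 1 ∷ []) ∷ (1 ∷ 0 ∷ 1 ∷ []) ∷ [])

A : Fin 3 → NMat
A f0 = A₀
A (fs f0) = A₁
A (fs (fs f0)) = A₂

-- V has columns v₁ = (0,0,1)ᵀ, v₂ = (1,0,1)ᵀ, v₃ = (1,1,1)ᵀ
Vmat : NMat
Vmat = fromRows ((0 ∷ 1 ∷ 1 ∷ []) ∷ (0 ∷ 0 ∷ 1 ∷ []) ∷ (1 ∷ 1 ∷ 1 ∷ []) ∷ [])

sum3 : (Fin 3 → ℕ) → ℕ
sum3 f = f f0 + f (fs f0) + f (fs (fs f0))

_·ᵥ_ : (Fin 3 → ℕ) → NMat → (Fin 3 → ℕ)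
(v ·ᵥ M) j = sum3 (λ l → v l * M l j)

vI : List (Fin 3) → Fin 3 → ℕ
vI I = foldl (λ w i → w ·ᵥ A i) (λ _ → 1) I

digitsVal : List (Fin 3) → ℕ
digitsVal = foldl (λ acc i → 3 * acc + toℕ i) 0

-- N = 3(3ⁿ-1)/2 + i₁3ⁿ + ⋯ + iₙ3 + k,  with k ∈ {1,2,3} encoded as Fin 3 (k = toℕ k' + 1)
sternIndex : List (Fin 3) → Fin 3 → ℕ
sternIndex I k = (3 * (3 ^ length I ∸ 1)) / 2 + 3 * digitsVal I + suc (toℕ k)

-- a is Stern's triatomic sequence: a_N = v_k(I) for N = sternIndex I k
-- (every N ≥ 1 arises from exactly one (I,k), so this determines a on N ≥ 1)
IsSternTriatomic : (ℕ → ℕ) → Set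
IsSternTriatomic a = ∀ (I : List (Fin 3)) (k : Fin 3) → a (sternIndex I k) ≡ vI I k

FPS : Set
FPS = ℕ → ℕ

_⊕_ : FPS → FPS → FPS
(f ⊕ g) n = f n + g n

convSum : FPS → FPS → ℕ → ℕ → ℕ
convSum f g n zero = f 0 * g n
convSum f g n (suc i) = f (suc i) * g (n ∸ suc i) + convSum f g n i

_⊛_ : FPS → FPS → FPS
(f ⊛ g) n = convSum f g n n

cst : ℕ → FPS
cst c zero = c
cst c (suc n) = 0

X^ : ℕ → FPS
X^ m n with n ≟ m
... | yes _ = 1
... | no _ = 0

zeroS : FPS
zeroS _ = 0

Mat : ℕ → ℕ → Set
Mat m n = Fin m → Fin n → FPS

sumFin : (n : ℕ) → (Fin n → FPS) → FPS
sumFin zero f = zeroS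
sumFin (suc n) f = f f0 ⊕ sumFin n (λ i → f (fs i))

_·ₘ_ : ∀ {m n p} → Mat m n → Mat n p → Mat m p
(M ·ₘ N) i j = sumFin _ (λ l → M i l ⊛ N l j)

_+ₘ_ : ∀ {m n} → Mat m n → Mat m n → Mat m n
(M +ₘ N) i j = M i j ⊕ N i j

zeroM : ∀ {m n} → Mat m n
zeroM _ _ = zeroS

_∙ₘ_ : ∀ {m n} → FPS → Mat m n → Mat m n
(s ∙ₘ M) i j = s ⊛ M i j

lift : NMat → Mat 3 3
lift M i j = cst (M i j)

Id₃ : Mat 3 3
Id₃ i j with toℕ i ≟ toℕ j
... | yes _ = cst 1
... | no _ = cst 0

Pat : FPS → Mat 3 3
Pat y = (lift A₀ +ₘ (y ∙ₘ lift A₁)) +ₘ ((y ⊛ y) ∙ₘ lift A₂)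

chain : ℕ → Mat 3 3
chain zero = Id₃
chain (suc k) = Pat (X^ (3 ^ suc k)) ·ₘ chain k

term : ℕ → Mat 3 3
term k = X^ ((3 * (3 ^ k ∸ 1)) / 2) ∙ₘ chain k

partialSum : ℕ → Mat 3 3
partialSum zero = zeroM
partialSum (suc K) = partialSum K +ₘ term (suc K)

-- Σ_{k≥1} term k = S in the x-adic (coefficientwise) topology:
-- every coefficient of every entry of the partial sums is eventually equal to that of S
HasSum : Mat 3 3 → Set
HasSum S = ∀ (i j : Fin 3) (n : ℕ) → ∃ λ K → ∀ K′ → K ≤ K′ → partialSum K′ i j n ≡ S i j n

e₃ᵀ : Mat 1 3
e₃ᵀ _ j with toℕ j ≟ 2
... | yes _ = cst 1
... | no _ = cst 0

xcol : Mat 3 1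
xcol i _ = X^ (suc (toℕ i))

rhsSeries : Mat 3 3 → FPS
rhsSeries S = (((e₃ᵀ ·ₘ lift Vmat) ·ₘ (Id₃ +ₘ S)) ·ₘ xcol) f0 f0

genSeries : (ℕ → ℕ) → FPS
genSeries a zero = 0
genSeries a (suc n) = a (suc n)

module Submission where

-- Since e₃ᵀV = (1,1,1) and P(y) = A₀ + y A₁ + y² A₂, expanding the product gives
--   (1,1,1) x^{3(3^K−1)/2} P(x^{3^K}) ⋯ P(x³) = Σ_{|I| = K} x^{3(3^K−1)/2 + 3·val(I)} (1,1,1) A_I,
-- where val(I) is the base-3 value of I (the leftmost factor contributes the leading digit).
-- After multiplying column k by x^k, the coefficient of x^N on the right is therefore the sum of
-- v_k(I) over all (I, k) with sternIndex I k = N. This index map is a bijection onto the positive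
-- integers: |I| selects a block of length 3^{|I|+1}, and I followed by k is the base-3 expansion of
-- the offset inside it. Hence the coefficient is a_N. The K-th summand is divisible by x^K, so the
-- series over K converges coefficientwise.

open import Defs
open import Data.Nat using (ℕ; zero; suc; _+_; _*_; _∸_; _^_; _≤_; _<_; _≟_; _≤?_; z≤n; s≤s)
open import Data.Nat.Properties
open import Data.Nat.DivMod using (_/_; _%_; m*n/n≡m; m≡m%n+[m/n]*n; m%n<n; m<n*o⇒m/o<n)
open import Data.Nat.Tactic.RingSolver using (solve-∀)
open import Data.Fin using (Fin; toℕ; fromℕ<) renaming (zero to f0; suc to fs)
open import Data.Fin.Properties using (toℕ<n; toℕ-injective; toℕ-fromℕ<)
open import Data.List using (List; []; _∷_; _∷ʳ_; length; foldl)
open import Data.List.Properties using (∷-injectiveˡ; ∷-injectiveʳ; ∷ʳ-injective; foldl-∷ʳ; length-++)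
open import Data.Product using (∃; _×_; _,_; proj₁; proj₂)
open import Data.Empty using (⊥-elim)
open import Data.Sum using (inj₁; inj₂)
open import Function using (_∘_)
open import Relation.Binary.PropositionalEquality
open import Relation.Binary.Definitions using (tri<; tri≈; tri>)
open import Relation.Nullary using (yes; no; ¬_)

open ≡-Reasoning

sumTo : (ℕ → ℕ) → ℕ → ℕ
sumTo h zero = h 0
sumTo h (suc i) = h (suc i) + sumTo h i

convSum≡sumTo : ∀ f g n i → convSum f g n i ≡ sumTo (λ j → f j * g (n ∸ j)) i
convSum≡sumTo f g n zero = refl
convSum≡sumTo f g n (suc i) = cong (f (suc i) * g (n ∸ suc i) +_) (convSum≡sumTo f g n i)

sumTo-zero : ∀ h i → (∀ j → j ≤ i → h j ≡ 0) → sumTo h i ≡ 0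
sumTo-zero h zero h≡0 = h≡0 0 z≤n
sumTo-zero h (suc i) h≡0 =
  cong₂ _+_ (h≡0 (suc i) ≤-refl) (sumTo-zero h i (λ j j≤i → h≡0 j (m≤n⇒m≤1+n j≤i)))

sumTo-single : ∀ h i t → t ≤ i → (∀ j → j ≤ i → j ≢ t → h j ≡ 0) → sumTo h i ≡ h t
sumTo-single h zero zero _ _ = refl
sumTo-single h (suc i) t t≤1+i h≡0 with m≤n⇒m<n∨m≡n t≤1+i
... | inj₂ refl = begin
  h (suc i) + sumTo h i ≡⟨ cong (h (suc i) +_) (sumTo-zero h i below) ⟩
  h (suc i) + 0         ≡⟨ +-identityʳ _ ⟩
  h (suc i)             ∎
  where
  below : ∀ j → j ≤ i → h j ≡ 0
  below j j≤i = h≡0 j (m≤n⇒m≤1+n j≤i) (<⇒≢ (s≤s j≤i))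
... | inj₁ (s≤s t≤i) =
  cong₂ _+_ (h≡0 (suc i) ≤-refl (≢-sym (<⇒≢ (s≤s t≤i))))
            (sumTo-single h i t t≤i (λ j j≤i → h≡0 j (m≤n⇒m≤1+n j≤i)))

⊛-distribʳ-⊕ : ∀ f f′ g n → ((f ⊕ f′) ⊛ g) n ≡ (f ⊛ g) n + (f′ ⊛ g) n
⊛-distribʳ-⊕ f f′ g n = go n
  where
  interchange : ∀ (a b c d : ℕ) → (a + b) + (c + d) ≡ (a + c) + (b + d)
  interchange = solve-∀
  go : ∀ i → convSum (f ⊕ f′) g n i ≡ convSum f g n i + convSum f′ g n i
  go zero = *-distribʳ-+ (g n) (f 0) (f′ 0)
  go (suc i) = begin
    (f (suc i) + f′ (suc i)) * g (n ∸ suc i) + convSum (f ⊕ f′) g n i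
      ≡⟨ cong₂ _+_ (*-distribʳ-+ (g (n ∸ suc i)) (f (suc i)) (f′ (suc i))) (go i) ⟩
    (f (suc i) * g (n ∸ suc i) + f′ (suc i) * g (n ∸ suc i)) + (convSum f g n i + convSum f′ g n i)
      ≡⟨ interchange (f (suc i) * g (n ∸ suc i)) _ (convSum f g n i) _ ⟩
    convSum f g n (suc i) + convSum f′ g n (suc i) ∎

shift : ℕ → FPS → FPS
shift m g n with m ≤? n
... | yes _ = g (n ∸ m)
... | no _ = 0

shift-≥ : ∀ m g n → m ≤ n → shift m g n ≡ g (n ∸ m)
shift-≥ m g n m≤n with m ≤? n
... | yes _ = refl
... | no m≰n = ⊥-elim (m≰n m≤n)

shift-< : ∀ m g n → n < m → shift m g n ≡ 0
shift-< m g n n<m with m ≤? n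
... | yes m≤n = ⊥-elim (<⇒≱ n<m m≤n)
... | no _ = refl

shift-cong : ∀ m g g′ n → (∀ p → p ≤ n → g p ≡ g′ p) → shift m g n ≡ shift m g′ n
shift-cong m g g′ n g≡g′ with ≤-<-connex m n
... | inj₁ m≤n = begin
  shift m g n   ≡⟨ shift-≥ m g n m≤n ⟩
  g (n ∸ m)     ≡⟨ g≡g′ (n ∸ m) (m∸n≤m n m) ⟩
  g′ (n ∸ m)    ≡⟨ shift-≥ m g′ n m≤n ⟨
  shift m g′ n  ∎
... | inj₂ n<m = trans (shift-< m g n n<m) (sym (shift-< m g′ n n<m))

IsMonomial : FPS → ℕ → ℕ → Set
IsMonomial f t c = (f t ≡ c) × (∀ p → p ≢ t → f p ≡ 0)

X^-isMonomial : ∀ m → IsMonomial (X^ m) m 1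
X^-isMonomial m = at , off
  where
  at : X^ m m ≡ 1
  at with m ≟ m
  ... | yes _ = refl
  ... | no m≢m = ⊥-elim (m≢m refl)
  off : ∀ p → p ≢ m → X^ m p ≡ 0
  off p p≢m with p ≟ m
  ... | yes p≡m = ⊥-elim (p≢m p≡m)
  ... | no _ = refl

cst-isMonomial : ∀ c → IsMonomial (cst c) 0 c
cst-isMonomial c = refl , off
  where
  off : ∀ p → p ≢ 0 → cst c p ≡ 0
  off zero p≢0 = ⊥-elim (p≢0 refl)
  off (suc p) _ = refl

isMonomial-cong : ∀ {f g t c} → (∀ p → f p ≡ g p) → IsMonomial f t c → IsMonomial g t c
isMonomial-cong f≡g (at , off) = trans (sym (f≡g _)) at , λ p p≢t → trans (sym (f≡g p)) (off p p≢t)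

⊛-monomialˡ : ∀ f g t c → IsMonomial f t c → ∀ n → (f ⊛ g) n ≡ c * shift t g n
⊛-monomialˡ f g t c (at , off) n with ≤-<-connex t n
... | inj₁ t≤n = begin
  convSum f g n n                  ≡⟨ convSum≡sumTo f g n n ⟩
  sumTo (λ j → f j * g (n ∸ j)) n  ≡⟨ sumTo-single _ n t t≤n (λ j _ j≢t → cong (_* g (n ∸ j)) (off j j≢t)) ⟩
  f t * g (n ∸ t)                  ≡⟨ cong₂ _*_ at (sym (shift-≥ t g n t≤n)) ⟩
  c * shift t g n                  ∎
... | inj₂ n<t = begin
  convSum f g n n                  ≡⟨ convSum≡sumTo f g n n ⟩
  sumTo (λ j → f j * g (n ∸ j)) n  ≡⟨ sumTo-zero _ n vanish ⟩
  0                                ≡⟨ *-zeroʳ c ⟨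
  c * 0                            ≡⟨ cong (c *_) (shift-< t g n n<t) ⟨
  c * shift t g n                  ∎
  where
  vanish : ∀ j → j ≤ n → f j * g (n ∸ j) ≡ 0
  vanish j j≤n = cong (_* g (n ∸ j)) (off j (λ j≡t → <⇒≱ n<t (subst (_≤ n) j≡t j≤n)))

⊛-monomialʳ : ∀ f g t c → IsMonomial g t c → ∀ n → (f ⊛ g) n ≡ shift t f n * c
⊛-monomialʳ f g t c (at , off) n with ≤-<-connex t n
... | inj₁ t≤n = begin
  convSum f g n n                  ≡⟨ convSum≡sumTo f g n n ⟩
  sumTo (λ j → f j * g (n ∸ j)) n  ≡⟨ sumTo-single _ n (n ∸ t) (m∸n≤m n t) vanish ⟩
  f (n ∸ t) * g (n ∸ (n ∸ t))      ≡⟨ cong (λ e → f (n ∸ t) * g e) (m∸[m∸n]≡n t≤n) ⟩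
  f (n ∸ t) * g t                  ≡⟨ cong₂ _*_ (sym (shift-≥ t f n t≤n)) at ⟩
  shift t f n * c                  ∎
  where
  vanish : ∀ j → j ≤ n → j ≢ n ∸ t → f j * g (n ∸ j) ≡ 0
  vanish j j≤n j≢n∸t = trans (cong (f j *_) (off (n ∸ j) n∸j≢t)) (*-zeroʳ (f j))
    where
    n∸j≢t : n ∸ j ≢ t
    n∸j≢t n∸j≡t = j≢n∸t (trans (sym (m∸[m∸n]≡n j≤n)) (cong (n ∸_) n∸j≡t))
... | inj₂ n<t = begin
  convSum f g n n                  ≡⟨ convSum≡sumTo f g n n ⟩
  sumTo (λ j → f j * g (n ∸ j)) n  ≡⟨ sumTo-zero _ n vanish ⟩
  0                                ≡⟨ cong (_* c) (shift-< t f n n<t) ⟨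
  shift t f n * c                  ∎
  where
  vanish : ∀ j → j ≤ n → f j * g (n ∸ j) ≡ 0
  vanish j _ = trans (cong (f j *_) (off (n ∸ j) (λ n∸j≡t → <⇒≱ n<t (subst (_≤ n) n∸j≡t (m∸n≤m n j)))))
                     (*-zeroʳ (f j))

⊛-isMonomial : ∀ {f g t s c d} → IsMonomial f t c → IsMonomial g s d → IsMonomial (f ⊛ g) (t + s) (c * d)
⊛-isMonomial {f} {g} {t} {s} {c} {d} f-mon (g-at , g-off) = at , off
  where
  at : (f ⊛ g) (t + s) ≡ c * d
  at = begin
    (f ⊛ g) (t + s)        ≡⟨ ⊛-monomialˡ f g t c f-mon (t + s) ⟩
    c * shift t g (t + s)  ≡⟨ cong (c *_) (shift-≥ t g (t + s) (m≤m+n t s)) ⟩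
    c * g (t + s ∸ t)      ≡⟨ cong (λ e → c * g e) (m+n∸m≡n t s) ⟩
    c * g s                ≡⟨ cong (c *_) g-at ⟩
    c * d                  ∎
  off : ∀ p → p ≢ t + s → (f ⊛ g) p ≡ 0
  off p p≢t+s = trans (⊛-monomialˡ f g t c f-mon p) (trans (cong (c *_) shifted) (*-zeroʳ c))
    where
    shifted : shift t g p ≡ 0
    shifted with ≤-<-connex t p
    ... | inj₁ t≤p = trans (shift-≥ t g p t≤p)
                           (g-off (p ∸ t) (λ p∸t≡s → p≢t+s (trans (sym (m+[n∸m]≡n t≤p)) (cong (t +_) p∸t≡s))))
    ... | inj₂ p<t = shift-< t g p p<t

dot : (Fin 3 → ℕ) → (Fin 3 → ℕ) → ℕ
dot u v = sum3 (λ l → u l * v l)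

sum3-cong : ∀ {f g : Fin 3 → ℕ} → (∀ i → f i ≡ g i) → sum3 f ≡ sum3 g
sum3-cong f≡g = cong₂ _+_ (cong₂ _+_ (f≡g f0) (f≡g (fs f0))) (f≡g (fs (fs f0)))

sum3-+ : ∀ (f g : Fin 3 → ℕ) → sum3 (λ i → f i + g i) ≡ sum3 f + sum3 g
sum3-+ f g = lemma (f f0) (f (fs f0)) (f (fs (fs f0))) (g f0) (g (fs f0)) (g (fs (fs f0)))
  where
  lemma : ∀ (a b c d e h : ℕ) → (a + d) + (b + e) + (c + h) ≡ (a + b + c) + (d + e + h)
  lemma = solve-∀

*-sum3 : ∀ c (f : Fin 3 → ℕ) → c * sum3 f ≡ sum3 (λ i → c * f i)
*-sum3 c f = lemma c (f f0) (f (fs f0)) (f (fs (fs f0)))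
  where
  lemma : ∀ (c a b d : ℕ) → c * (a + b + d) ≡ c * a + c * b + c * d
  lemma = solve-∀

sum3-comm : ∀ (f : Fin 3 → Fin 3 → ℕ) → sum3 (λ i → sum3 (f i)) ≡ sum3 (λ l → sum3 (λ i → f i l))
sum3-comm f = lemma (f f0 f0) (f f0 (fs f0)) (f f0 (fs (fs f0)))
                    (f (fs f0) f0) (f (fs f0) (fs f0)) (f (fs f0) (fs (fs f0)))
                    (f (fs (fs f0)) f0) (f (fs (fs f0)) (fs f0)) (f (fs (fs f0)) (fs (fs f0)))
  where
  lemma : ∀ (a b c d e g h k r : ℕ) → (a + b + c) + (d + e + g) + (h + k + r) ≡ (a + d + h) + (b + e + k) + (c + g + r)
  lemma = solve-∀

·ᵥ-dot : ∀ (w : Fin 3 → ℕ) (B : NMat) (g : Fin 3 → ℕ) → dot (w ·ᵥ B) g ≡ sum3 (λ i → w i * dot (B i) g)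
·ᵥ-dot w B g = begin
  sum3 (λ l → sum3 (λ i → w i * B i l) * g l)    ≡⟨ sum3-cong (λ l → trans (*-comm _ (g l)) (*-sum3 (g l) (λ i → w i * B i l))) ⟩
  sum3 (λ l → sum3 (λ i → g l * (w i * B i l)))  ≡⟨ sum3-comm (λ i l → g l * (w i * B i l)) ⟨
  sum3 (λ i → sum3 (λ l → g l * (w i * B i l)))  ≡⟨ sum3-cong (λ i → sum3-cong (λ l → reassoc (g l) (w i) (B i l))) ⟩
  sum3 (λ i → sum3 (λ l → w i * (B i l * g l)))  ≡⟨ sum3-cong (λ i → *-sum3 (w i) (λ l → B i l * g l)) ⟨
  sum3 (λ i → w i * dot (B i) g)                 ∎
  where
  reassoc : ∀ (a b c : ℕ) → a * (b * c) ≡ b * (c * a)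
  reassoc = solve-∀

dot-shift : ∀ m (v : Fin 3 → ℕ) (g : Fin 3 → FPS) n → dot v (λ l → shift m (g l) n) ≡ shift m (λ p → dot v (λ l → g l p)) n
dot-shift m v g n with ≤-<-connex m n
... | inj₁ m≤n = trans (sum3-cong (λ l → cong (v l *_) (shift-≥ m (g l) n m≤n))) (sym (shift-≥ m _ n m≤n))
... | inj₂ n<m = trans (sum3-cong (λ l → trans (cong (v l *_) (shift-< m (g l) n n<m)) (*-zeroʳ (v l))))
                       (sym (shift-< m _ n n<m))

sumFin-3 : ∀ (f : Fin 3 → FPS) n → sumFin 3 f n ≡ sum3 (λ l → f l n)
sumFin-3 f n = lemma (f f0 n) (f (fs f0) n) (f (fs (fs f0)) n)
  where
  lemma : ∀ (a b c : ℕ) → a + (b + (c + 0)) ≡ a + b + c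
  lemma = solve-∀

Pat-⊛ : ∀ m i l g n → (Pat (X^ m) i l ⊛ g) n ≡ sum3 (λ d → A d i l * shift (toℕ d * m) g n)
Pat-⊛ m i l g n = begin
  (Pat (X^ m) i l ⊛ g) n
    ≡⟨ ⊛-distribʳ-⊕ _ _ g n ⟩
  ((cst (A₀ i l) ⊕ (X^ m ⊛ cst (A₁ i l))) ⊛ g) n + (((X^ m ⊛ X^ m) ⊛ cst (A₂ i l)) ⊛ g) n
    ≡⟨ cong (_+ (((X^ m ⊛ X^ m) ⊛ cst (A₂ i l)) ⊛ g) n) (⊛-distribʳ-⊕ _ _ g n) ⟩
  (cst (A₀ i l) ⊛ g) n + ((X^ m ⊛ cst (A₁ i l)) ⊛ g) n + (((X^ m ⊛ X^ m) ⊛ cst (A₂ i l)) ⊛ g) n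
    ≡⟨ cong₂ _+_ (cong₂ _+_ (⊛-monomialˡ _ g 0 _ (cst-isMonomial _) n)
                            (⊛-monomialˡ _ g _ _ (⊛-isMonomial (X^-isMonomial m) (cst-isMonomial _)) n))
                 (⊛-monomialˡ _ g _ _ (⊛-isMonomial (⊛-isMonomial (X^-isMonomial m) (X^-isMonomial m))
                                                    (cst-isMonomial _)) n) ⟩
  A₀ i l * shift 0 g n + 1 * A₁ i l * shift (m + 0) g n + 1 * 1 * A₂ i l * shift (m + m + 0) g n
    ≡⟨ cong₂ _+_ (cong (A₀ i l * shift 0 g n +_) (cong (_* shift (m + 0) g n) (*-identityˡ (A₁ i l))))
                 (cong₂ _*_ (*-identityˡ (A₂ i l)) (cong (λ e → shift e g n) (+-assoc m m 0))) ⟩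
  A₀ i l * shift 0 g n + A₁ i l * shift (1 * m) g n + A₂ i l * shift (2 * m) g n
    ∎

rowCoeff : ℕ → (Fin 3 → ℕ) → Fin 3 → FPS
rowCoeff K w j p = dot w (λ i → chain K i j p)

chain-suc : ∀ K i j q → chain (suc K) i j q ≡ sum3 (λ d → dot (A d i) (λ l → shift (toℕ d * 3 ^ suc K) (chain K l j) q))
chain-suc K i j q = begin
  sumFin 3 (λ l → Pat (X^ (3 ^ suc K)) i l ⊛ chain K l j) q
    ≡⟨ sumFin-3 (λ l → Pat (X^ (3 ^ suc K)) i l ⊛ chain K l j) q ⟩
  sum3 (λ l → (Pat (X^ (3 ^ suc K)) i l ⊛ chain K l j) q)
    ≡⟨ sum3-cong (λ l → Pat-⊛ (3 ^ suc K) i l (chain K l j) q) ⟩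
  sum3 (λ l → sum3 (λ d → A d i l * shift (toℕ d * 3 ^ suc K) (chain K l j) q))
    ≡⟨ sum3-comm (λ l d → A d i l * shift (toℕ d * 3 ^ suc K) (chain K l j) q) ⟩
  sum3 (λ d → dot (A d i) (λ l → shift (toℕ d * 3 ^ suc K) (chain K l j) q))
    ∎

rowCoeff-suc : ∀ K w j q → rowCoeff (suc K) w j q ≡ sum3 (λ d → shift (toℕ d * 3 ^ suc K) (rowCoeff K (w ·ᵥ A d) j) q)
rowCoeff-suc K w j q = begin
  sum3 (λ i → w i * chain (suc K) i j q)
    ≡⟨ sum3-cong (λ i → trans (cong (w i *_) (chain-suc K i j q)) (*-sum3 (w i) (λ d → dot (A d i) (s d)))) ⟩
  sum3 (λ i → sum3 (λ d → w i * dot (A d i) (s d)))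
    ≡⟨ sum3-comm (λ i d → w i * dot (A d i) (s d)) ⟩
  sum3 (λ d → sum3 (λ i → w i * dot (A d i) (s d)))
    ≡⟨ sum3-cong (λ d → ·ᵥ-dot w (A d) (s d)) ⟨
  sum3 (λ d → dot (w ·ᵥ A d) (s d))
    ≡⟨ sum3-cong (λ d → dot-shift (toℕ d * 3 ^ suc K) (w ·ᵥ A d) (λ l → chain K l j) q) ⟩
  sum3 (λ d → shift (toℕ d * 3 ^ suc K) (rowCoeff K (w ·ᵥ A d) j) q)
    ∎
  where
  s : Fin 3 → Fin 3 → ℕ
  s d l = shift (toℕ d * 3 ^ suc K) (chain K l j) q

sumWords : ℕ → (List (Fin 3) → ℕ) → ℕ
sumWords zero h = h []
sumWords (suc K) h = sum3 (λ i → sumWords K (λ I → h (i ∷ I)))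

sumWords-cong : ∀ K {h h′} → (∀ I → length I ≡ K → h I ≡ h′ I) → sumWords K h ≡ sumWords K h′
sumWords-cong zero h≡h′ = h≡h′ [] refl
sumWords-cong (suc K) h≡h′ = sum3-cong (λ i → sumWords-cong K (λ I |I|≡K → h≡h′ (i ∷ I) (cong suc |I|≡K)))

sumWords-zero : ∀ K h → (∀ I → length I ≡ K → h I ≡ 0) → sumWords K h ≡ 0
sumWords-zero K h h≡0 = trans (sumWords-cong K h≡0) (vanish K)
  where
  vanish : ∀ K → sumWords K (λ _ → 0) ≡ 0
  vanish zero = refl
  vanish (suc K) = cong (λ z → z + z + z) (vanish K)

sum3-single : ∀ (f : Fin 3 → ℕ) i₀ → (∀ i → i ≢ i₀ → f i ≡ 0) → sum3 f ≡ f i₀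
sum3-single f f0 f≡0 =
  trans (cong₂ _+_ (cong (f f0 +_) (f≡0 (fs f0) (λ ()))) (f≡0 (fs (fs f0)) (λ ())))
        (trans (+-identityʳ _) (+-identityʳ _))
sum3-single f (fs f0) f≡0 =
  trans (cong₂ _+_ (cong (_+ f (fs f0)) (f≡0 f0 (λ ()))) (f≡0 (fs (fs f0)) (λ ()))) (+-identityʳ _)
sum3-single f (fs (fs f0)) f≡0 =
  cong (_+ f (fs (fs f0))) (cong₂ _+_ (f≡0 f0 (λ ())) (f≡0 (fs f0) (λ ())))

sumWords-single : ∀ K h I₀ → length I₀ ≡ K → (∀ I → length I ≡ K → I ≢ I₀ → h I ≡ 0) → sumWords K h ≡ h I₀
sumWords-single zero h [] refl _ = refl
sumWords-single (suc K) h (i₀ ∷ I₀) |I₀|≡ h≡0 = begin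
  sum3 (λ i → sumWords K (λ I → h (i ∷ I)))  ≡⟨ sum3-single _ i₀ otherDigit ⟩
  sumWords K (λ I → h (i₀ ∷ I))              ≡⟨ sumWords-single K _ I₀ (suc-injective |I₀|≡) sameDigit ⟩
  h (i₀ ∷ I₀)                                ∎
  where
  otherDigit : ∀ i → i ≢ i₀ → sumWords K (λ I → h (i ∷ I)) ≡ 0
  otherDigit i i≢i₀ = sumWords-zero K _ (λ I |I|≡K → h≡0 (i ∷ I) (cong suc |I|≡K) (i≢i₀ ∘ ∷-injectiveˡ))
  sameDigit : ∀ I → length I ≡ K → I ≢ I₀ → h (i₀ ∷ I) ≡ 0
  sameDigit I |I|≡K I≢I₀ = h≡0 (i₀ ∷ I) (cong suc |I|≡K) (I≢I₀ ∘ ∷-injectiveʳ)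

shift-sumWords : ∀ m K (g : List (Fin 3) → FPS) n → shift m (λ p → sumWords K (λ I → g I p)) n ≡ sumWords K (λ I → shift m (g I) n)
shift-sumWords m K g n with ≤-<-connex m n
... | inj₁ m≤n = trans (shift-≥ m _ n m≤n) (sumWords-cong K (λ I _ → sym (shift-≥ m (g I) n m≤n)))
... | inj₂ n<m = trans (shift-< m _ n n<m) (sym (sumWords-zero K _ (λ I _ → shift-< m (g I) n n<m)))

δ : ℕ → ℕ → ℕ
δ a b with a ≟ b
... | yes _ = 1
... | no _ = 0

δ-≡ : ∀ {a b} → a ≡ b → δ a b ≡ 1
δ-≡ {a} {b} a≡b with a ≟ b
... | yes _ = refl
... | no a≢b = ⊥-elim (a≢b a≡b)

δ-≢ : ∀ {a b} → a ≢ b → δ a b ≡ 0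
δ-≢ {a} {b} a≢b with a ≟ b
... | yes a≡b = ⊥-elim (a≢b a≡b)
... | no _ = refl

shift-δ : ∀ m a v n → shift m (λ p → δ a p * v) n ≡ δ (m + a) n * v
shift-δ m a v n with ≤-<-connex m n | a ≟ n ∸ m
... | inj₁ m≤n | yes a≡n∸m = trans (shift-≥ m _ n m≤n)
  (cong (_* v) (trans (δ-≡ a≡n∸m) (sym (δ-≡ (trans (cong (m +_) a≡n∸m) (m+[n∸m]≡n m≤n))))))
... | inj₁ m≤n | no a≢n∸m = trans (shift-≥ m _ n m≤n)
  (cong (_* v) (trans (δ-≢ a≢n∸m) (sym (δ-≢ (λ m+a≡n → a≢n∸m (trans (sym (m+n∸m≡n m a)) (cong (_∸ m) m+a≡n)))))))
... | inj₂ n<m | _ = trans (shift-< m _ n n<m)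
  (sym (cong (_* v) (δ-≢ (λ m+a≡n → <⇒≱ n<m (subst (m ≤_) m+a≡n (m≤m+n m a))))))

digitsVal-∷ : ∀ i I → digitsVal (i ∷ I) ≡ toℕ i * 3 ^ length I + digitsVal I
digitsVal-∷ i I = accumulate (toℕ i) I
  where
  accumulate : ∀ acc I → foldl (λ acc i → 3 * acc + toℕ i) acc I ≡ acc * 3 ^ length I + digitsVal I
  accumulate acc [] = sym (trans (+-identityʳ _) (*-identityʳ acc))
  accumulate acc (x ∷ I) = begin
    foldl _ (3 * acc + toℕ x) I                         ≡⟨ accumulate (3 * acc + toℕ x) I ⟩
    (3 * acc + toℕ x) * 3 ^ length I + digitsVal I      ≡⟨ regroup acc (toℕ x) (3 ^ length I) (digitsVal I) ⟩
    acc * 3 ^ suc (length I) + (toℕ x * 3 ^ length I + digitsVal I)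
      ≡⟨ cong (acc * 3 ^ suc (length I) +_) (accumulate (toℕ x) I) ⟨
    acc * 3 ^ suc (length I) + digitsVal (x ∷ I)        ∎
    where
    regroup : ∀ (a x P D : ℕ) → (3 * a + x) * P + D ≡ a * (3 * P) + (x * P + D)
    regroup = solve-∀

3*digitsVal-∷ : ∀ i I → 3 * digitsVal (i ∷ I) ≡ toℕ i * 3 ^ suc (length I) + 3 * digitsVal I
3*digitsVal-∷ i I = trans (cong (3 *_) (digitsVal-∷ i I)) (regroup (toℕ i) (3 ^ length I) (digitsVal I))
  where
  regroup : ∀ (x P D : ℕ) → 3 * (x * P + D) ≡ x * (3 * P) + 3 * D
  regroup = solve-∀

wordAction : (Fin 3 → ℕ) → List (Fin 3) → Fin 3 → ℕ
wordAction w I = foldl (λ w i → w ·ᵥ A i) w I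

rowCoeff-zero : ∀ w j q → rowCoeff 0 w j q ≡ δ 0 q * w j
rowCoeff-zero w j (suc q) = sum3-cong (λ i → trans (cong (w i *_) (Id₃-suc i j)) (*-zeroʳ (w i)))
  where
  Id₃-suc : ∀ i j → Id₃ i j (suc q) ≡ 0
  Id₃-suc i j with toℕ i ≟ toℕ j
  ... | yes _ = refl
  ... | no _ = refl
rowCoeff-zero w f0 zero = lemma (w f0) (w (fs f0)) (w (fs (fs f0)))
  where
  lemma : ∀ (a b c : ℕ) → a * 1 + b * 0 + c * 0 ≡ a + 0
  lemma = solve-∀
rowCoeff-zero w (fs f0) zero = lemma (w f0) (w (fs f0)) (w (fs (fs f0)))
  where
  lemma : ∀ (a b c : ℕ) → a * 0 + b * 1 + c * 0 ≡ b + 0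
  lemma = solve-∀
rowCoeff-zero w (fs (fs f0)) zero = lemma (w f0) (w (fs f0)) (w (fs (fs f0)))
  where
  lemma : ∀ (a b c : ℕ) → a * 0 + b * 0 + c * 1 ≡ c + 0
  lemma = solve-∀

rowCoeff-words : ∀ K w j q → rowCoeff K w j q ≡ sumWords K (λ I → δ (3 * digitsVal I) q * wordAction w I j)
rowCoeff-words zero w j q = rowCoeff-zero w j q
rowCoeff-words (suc K) w j q = begin
  rowCoeff (suc K) w j q
    ≡⟨ rowCoeff-suc K w j q ⟩
  sum3 (λ d → shift (m d) (rowCoeff K (w ·ᵥ A d) j) q)
    ≡⟨ sum3-cong (λ d → shift-cong (m d) _ _ q (λ p _ → rowCoeff-words K (w ·ᵥ A d) j p)) ⟩
  sum3 (λ d → shift (m d) (λ p → sumWords K (λ I → δ (3 * digitsVal I) p * wordAction (w ·ᵥ A d) I j)) q)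
    ≡⟨ sum3-cong (λ d → shift-sumWords (m d) K (λ I p → δ (3 * digitsVal I) p * wordAction (w ·ᵥ A d) I j) q) ⟩
  sum3 (λ d → sumWords K (λ I → shift (m d) (λ p → δ (3 * digitsVal I) p * wordAction (w ·ᵥ A d) I j) q))
    ≡⟨ sum3-cong (λ d → sumWords-cong K (λ I |I|≡K → leadingDigit d I |I|≡K)) ⟩
  sumWords (suc K) (λ I → δ (3 * digitsVal I) q * wordAction w I j)
    ∎
  where
  m : Fin 3 → ℕ
  m d = toℕ d * 3 ^ suc K
  leadingDigit : ∀ d I → length I ≡ K →
    shift (m d) (λ p → δ (3 * digitsVal I) p * wordAction (w ·ᵥ A d) I j) q ≡ δ (3 * digitsVal (d ∷ I)) q * wordAction w (d ∷ I) j
  leadingDigit d I refl = trans (shift-δ (m d) _ _ q) (cong (λ e → δ e q * wordAction w (d ∷ I) j) (sym (3*digitsVal-∷ d I)))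

sumWords≤ : ℕ → (List (Fin 3) → ℕ) → ℕ
sumWords≤ zero h = sumWords 0 h
sumWords≤ (suc P) h = sumWords≤ P h + sumWords (suc P) h

sumWords≤-cong : ∀ P {h h′} → (∀ I → length I ≤ P → h I ≡ h′ I) → sumWords≤ P h ≡ sumWords≤ P h′
sumWords≤-cong zero h≡h′ = h≡h′ [] z≤n
sumWords≤-cong (suc P) h≡h′ =
  cong₂ _+_ (sumWords≤-cong P (λ I |I|≤P → h≡h′ I (m≤n⇒m≤1+n |I|≤P)))
            (sumWords-cong (suc P) (λ I |I|≡ → h≡h′ I (≤-reflexive |I|≡)))

sumWords≤-zero : ∀ P h → (∀ I → length I ≤ P → h I ≡ 0) → sumWords≤ P h ≡ 0
sumWords≤-zero zero h h≡0 = h≡0 [] z≤n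
sumWords≤-zero (suc P) h h≡0 =
  cong₂ _+_ (sumWords≤-zero P h (λ I |I|≤P → h≡0 I (m≤n⇒m≤1+n |I|≤P)))
            (sumWords-zero (suc P) h (λ I |I|≡ → h≡0 I (≤-reflexive |I|≡)))

sumWords≤-single : ∀ P h I₀ → length I₀ ≤ P → (∀ I → length I ≤ P → I ≢ I₀ → h I ≡ 0) → sumWords≤ P h ≡ h I₀
sumWords≤-single zero h [] _ _ = refl
sumWords≤-single (suc P) h I₀ |I₀|≤ h≡0 with m≤n⇒m<n∨m≡n |I₀|≤
... | inj₁ (s≤s |I₀|≤P) = begin
  sumWords≤ P h + sumWords (suc P) h
    ≡⟨ cong₂ _+_ (sumWords≤-single P h I₀ |I₀|≤P (λ I |I|≤P → h≡0 I (m≤n⇒m≤1+n |I|≤P)))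
                 (sumWords-zero (suc P) h (λ I |I|≡ → h≡0 I (≤-reflexive |I|≡) (longer I |I|≡))) ⟩
  h I₀ + 0
    ≡⟨ +-identityʳ _ ⟩
  h I₀ ∎
  where
  longer : ∀ I → length I ≡ suc P → I ≢ I₀
  longer I |I|≡ refl = <⇒≢ (s≤s |I₀|≤P) |I|≡
... | inj₂ |I₀|≡ = begin
  sumWords≤ P h + sumWords (suc P) h
    ≡⟨ cong₂ _+_ (sumWords≤-zero P h (λ I |I|≤P → h≡0 I (m≤n⇒m≤1+n |I|≤P) (shorter I |I|≤P)))
                 (sumWords-single (suc P) h I₀ |I₀|≡ (λ I |I|≡ → h≡0 I (≤-reflexive |I|≡))) ⟩
  0 + h I₀ ∎
  where
  shorter : ∀ I → length I ≤ P → I ≢ I₀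
  shorter I |I|≤P refl = <⇒≢ (s≤s |I|≤P) |I₀|≡

shift-sumWords≤ : ∀ m P (g : List (Fin 3) → FPS) n → shift m (λ p → sumWords≤ P (λ I → g I p)) n ≡ sumWords≤ P (λ I → shift m (g I) n)
shift-sumWords≤ m P g n with ≤-<-connex m n
... | inj₁ m≤n = trans (shift-≥ m _ n m≤n) (sumWords≤-cong P (λ I _ → sym (shift-≥ m (g I) n m≤n)))
... | inj₂ n<m = trans (shift-< m _ n n<m) (sym (sumWords≤-zero P _ (λ I _ → shift-< m (g I) n n<m)))

blockStart : ℕ → ℕ
blockStart zero = 0
blockStart (suc K) = blockStart K + 3 ^ suc K

blockStart-closedForm : ∀ K → (3 * (3 ^ K ∸ 1)) / 2 ≡ blockStart K
blockStart-closedForm K = begin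
  (3 * (3 ^ K ∸ 1)) / 2        ≡⟨ cong (_/ 2) (*-distribˡ-∸ 3 (3 ^ K) 1) ⟩
  (3 * 3 ^ K ∸ 3) / 2          ≡⟨ cong (λ e → (e ∸ 3) / 2) (twice K) ⟨
  (blockStart K * 2 + 3 ∸ 3) / 2 ≡⟨ cong (_/ 2) (m+n∸n≡m (blockStart K * 2) 3) ⟩
  blockStart K * 2 / 2         ≡⟨ m*n/n≡m (blockStart K) 2 ⟩
  blockStart K                 ∎
  where
  twice : ∀ K → blockStart K * 2 + 3 ≡ 3 * 3 ^ K
  twice zero = refl
  twice (suc K) = begin
    (blockStart K + 3 * 3 ^ K) * 2 + 3  ≡⟨ regroup (blockStart K) (3 ^ K) ⟩
    (blockStart K * 2 + 3) + 6 * 3 ^ K  ≡⟨ cong (_+ 6 * 3 ^ K) (twice K) ⟩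
    3 * 3 ^ K + 6 * 3 ^ K               ≡⟨ collect (3 ^ K) ⟩
    3 * (3 * 3 ^ K)                     ∎
    where
    regroup : ∀ (b P : ℕ) → (b + 3 * P) * 2 + 3 ≡ (b * 2 + 3) + 6 * P
    regroup = solve-∀
    collect : ∀ (P : ℕ) → 3 * P + 6 * P ≡ 3 * (3 * P)
    collect = solve-∀

blockStart-≥ : ∀ K → K ≤ blockStart K
blockStart-≥ zero = z≤n
blockStart-≥ (suc K) = subst (_≤ blockStart K + 3 ^ suc K) (+-comm K 1) (+-mono-≤ (blockStart-≥ K) (m^n>0 3 (suc K)))

blockStart-mono : ∀ {m n} → m ≤ n → blockStart m ≤ blockStart n
blockStart-mono {m} {zero} z≤n = ≤-refl
blockStart-mono {m} {suc n} m≤1+n with m≤n⇒m<n∨m≡n m≤1+n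
... | inj₁ (s≤s m≤n) = ≤-trans (blockStart-mono m≤n) (m≤m+n (blockStart n) _)
... | inj₂ refl = ≤-refl

-- the word I contributes (1,1,1) A_I to the coefficient of x^{wordExponent I} in (1,1,1) [Id₃ + Σ_K …]
wordExponent : List (Fin 3) → ℕ
wordExponent I = (3 * (3 ^ length I ∸ 1)) / 2 + 3 * digitsVal I

term-rowSum : ∀ K l p → sum3 (λ i → term K i l p) ≡ sumWords K (λ I → δ (wordExponent I) p * vI I l)
term-rowSum K l p = begin
  sum3 (λ i → (X^ c ⊛ chain K i l) p)
    ≡⟨ sum3-cong (λ i → ⊛-monomialˡ (X^ c) (chain K i l) c 1 (X^-isMonomial c) p) ⟩
  dot (λ _ → 1) (λ i → shift c (chain K i l) p)
    ≡⟨ dot-shift c (λ _ → 1) (λ i → chain K i l) p ⟩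
  shift c (rowCoeff K (λ _ → 1) l) p
    ≡⟨ shift-cong c _ _ p (λ q _ → rowCoeff-words K (λ _ → 1) l q) ⟩
  shift c (λ q → sumWords K (λ I → δ (3 * digitsVal I) q * vI I l)) p
    ≡⟨ shift-sumWords c K (λ I q → δ (3 * digitsVal I) q * vI I l) p ⟩
  sumWords K (λ I → shift c (λ q → δ (3 * digitsVal I) q * vI I l) p)
    ≡⟨ sumWords-cong K (λ { I refl → shift-δ c (3 * digitsVal I) (vI I l) p }) ⟩
  sumWords K (λ I → δ (wordExponent I) p * vI I l)
    ∎
  where
  c : ℕ
  c = (3 * (3 ^ K ∸ 1)) / 2

bracket-rowSum : ∀ P l p → sum3 (λ i → Id₃ i l p + partialSum P i l p) ≡ sumWords≤ P (λ I → δ (wordExponent I) p * vI I l)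
bracket-rowSum zero l p = trans (sum3-cong (λ i → trans (+-identityʳ (Id₃ i l p)) (sym (*-identityˡ (Id₃ i l p)))))
                                (rowCoeff-words 0 (λ _ → 1) l p)
bracket-rowSum (suc P) l p = begin
  sum3 (λ i → Id₃ i l p + (partialSum P i l p + term (suc P) i l p))
    ≡⟨ sum3-cong (λ i → sym (+-assoc (Id₃ i l p) (partialSum P i l p) (term (suc P) i l p))) ⟩
  sum3 (λ i → (Id₃ i l p + partialSum P i l p) + term (suc P) i l p)
    ≡⟨ sum3-+ (λ i → Id₃ i l p + partialSum P i l p) (λ i → term (suc P) i l p) ⟩
  sum3 (λ i → Id₃ i l p + partialSum P i l p) + sum3 (λ i → term (suc P) i l p)
    ≡⟨ cong₂ _+_ (bracket-rowSum P l p) (term-rowSum (suc P) l p) ⟩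
  sumWords≤ (suc P) (λ I → δ (wordExponent I) p * vI I l)
    ∎

-- The K-th summand is divisible by x^K, so the partial sums stabilise coefficientwise
term-vanishes : ∀ K i j n → n < K → term K i j n ≡ 0
term-vanishes K i j n n<K = begin
  (X^ c ⊛ chain K i j) n      ≡⟨ ⊛-monomialˡ (X^ c) (chain K i j) c 1 (X^-isMonomial c) n ⟩
  1 * shift c (chain K i j) n ≡⟨ cong (1 *_) (shift-< c (chain K i j) n n<c) ⟩
  0                           ∎
  where
  c : ℕ
  c = (3 * (3 ^ K ∸ 1)) / 2
  n<c : n < c
  n<c = subst (n <_) (sym (blockStart-closedForm K)) (<-≤-trans n<K (blockStart-≥ K))

partialSum-stable : ∀ i j n K → n ≤ K → partialSum K i j n ≡ partialSum n i j n
partialSum-stable i j zero zero _ = refl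
partialSum-stable i j n (suc K) n≤1+K with m≤n⇒m<n∨m≡n n≤1+K
... | inj₁ (s≤s n≤K) = begin
  partialSum K i j n + term (suc K) i j n ≡⟨ cong₂ _+_ (partialSum-stable i j n K n≤K) (term-vanishes (suc K) i j n (s≤s n≤K)) ⟩
  partialSum n i j n + 0                  ≡⟨ +-identityʳ _ ⟩
  partialSum n i j n                      ∎
... | inj₂ refl = refl

limit : Mat 3 3
limit i j n = partialSum n i j n

limit-hasSum : HasSum limit
limit-hasSum i j n = n , partialSum-stable i j n

e₃ᵀ-·ₘ : ∀ (M : Mat 3 3) m p → (e₃ᵀ ·ₘ M) f0 m p ≡ M (fs (fs f0)) m p
e₃ᵀ-·ₘ M m p = trans
  (cong₂ _+_ (⊛-monomialˡ (cst 0) (M f0 m) 0 0 (cst-isMonomial 0) p)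
    (cong₂ _+_ (⊛-monomialˡ (cst 0) (M (fs f0) m) 0 0 (cst-isMonomial 0) p)
      (cong (_+ 0) (⊛-monomialˡ (cst 1) (M (fs (fs f0)) m) 0 1 (cst-isMonomial 1) p))))
  (trans (+-identityʳ _) (*-identityˡ _))

e₃ᵀV-isMonomial : ∀ m → IsMonomial ((e₃ᵀ ·ₘ lift Vmat) f0 m) 0 1
e₃ᵀV-isMonomial m = isMonomial-cong (λ p → sym (trans (e₃ᵀ-·ₘ (lift Vmat) m p) (lastRow m p))) (cst-isMonomial 1)
  where
  lastRow : ∀ m p → lift Vmat (fs (fs f0)) m p ≡ cst 1 p
  lastRow f0 p = refl
  lastRow (fs f0) p = refl
  lastRow (fs (fs f0)) p = refl

bracketRow : Fin 3 → FPS
bracketRow = ((e₃ᵀ ·ₘ lift Vmat) ·ₘ (Id₃ +ₘ limit)) f0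

bracketRow-coeff : ∀ N l p → p ≤ N → bracketRow l p ≡ sumWords≤ N (λ I → δ (wordExponent I) p * vI I l)
bracketRow-coeff N l p p≤N = begin
  sumFin 3 (λ m → (e₃ᵀ ·ₘ lift Vmat) f0 m ⊛ (Id₃ +ₘ limit) m l) p
    ≡⟨ sumFin-3 (λ m → (e₃ᵀ ·ₘ lift Vmat) f0 m ⊛ (Id₃ +ₘ limit) m l) p ⟩
  sum3 (λ m → ((e₃ᵀ ·ₘ lift Vmat) f0 m ⊛ (Id₃ +ₘ limit) m l) p)
    ≡⟨ sum3-cong (λ m → trans (⊛-monomialˡ _ ((Id₃ +ₘ limit) m l) 0 1 (e₃ᵀV-isMonomial m) p) (*-identityˡ _)) ⟩
  sum3 (λ m → Id₃ m l p + partialSum p m l p)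
    ≡⟨ sum3-cong (λ m → cong (Id₃ m l p +_) (sym (partialSum-stable m l p N p≤N))) ⟩
  sum3 (λ m → Id₃ m l p + partialSum N m l p)
    ≡⟨ bracket-rowSum N l p ⟩
  sumWords≤ N (λ I → δ (wordExponent I) p * vI I l)
    ∎

rhsSeries-coeff : ∀ N → rhsSeries limit N ≡ sum3 (λ l → sumWords≤ N (λ I → δ (sternIndex I l) N * vI I l))
rhsSeries-coeff N = begin
  sumFin 3 (λ l → bracketRow l ⊛ X^ (suc (toℕ l))) N
    ≡⟨ sumFin-3 (λ l → bracketRow l ⊛ X^ (suc (toℕ l))) N ⟩
  sum3 (λ l → (bracketRow l ⊛ X^ (suc (toℕ l))) N)
    ≡⟨ sum3-cong {g = λ l → shift (suc (toℕ l)) (bracketRow l) N}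
                 (λ l → trans (⊛-monomialʳ (bracketRow l) _ _ 1 (X^-isMonomial (suc (toℕ l))) N) (*-identityʳ _)) ⟩
  sum3 (λ l → shift (suc (toℕ l)) (bracketRow l) N)
    ≡⟨ sum3-cong (λ l → shift-cong (suc (toℕ l)) (bracketRow l) _ N (λ p p≤N → bracketRow-coeff N l p p≤N)) ⟩
  sum3 (λ l → shift (suc (toℕ l)) (λ p → sumWords≤ N (λ I → δ (wordExponent I) p * vI I l)) N)
    ≡⟨ sum3-cong (λ l → shift-sumWords≤ (suc (toℕ l)) N (λ I p → δ (wordExponent I) p * vI I l) N) ⟩
  sum3 (λ l → sumWords≤ N (λ I → shift (suc (toℕ l)) (λ p → δ (wordExponent I) p * vI I l) N))
    ≡⟨ sum3-cong (λ l → sumWords≤-cong N (λ I _ → shifted l I)) ⟩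
  sum3 (λ l → sumWords≤ N (λ I → δ (sternIndex I l) N * vI I l))
    ∎
  where
  shifted : ∀ l I → shift (suc (toℕ l)) (λ p → δ (wordExponent I) p * vI I l) N ≡ δ (sternIndex I l) N * vI I l
  shifted l I = trans (shift-δ (suc (toℕ l)) (wordExponent I) (vI I l) N)
                      (cong (λ e → δ e N * vI I l) (+-comm (suc (toℕ l)) (wordExponent I)))

digitsVal-∷ʳ : ∀ I i → digitsVal (I ∷ʳ i) ≡ 3 * digitsVal I + toℕ i
digitsVal-∷ʳ I i = foldl-∷ʳ (λ acc i → 3 * acc + toℕ i) 0 i I

length-∷ʳ : ∀ (I : List (Fin 3)) i → length (I ∷ʳ i) ≡ suc (length I)
length-∷ʳ I i = trans (length-++ I) (+-comm (length I) 1)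

digitsVal<3^length : ∀ I → digitsVal I < 3 ^ length I
digitsVal<3^length [] = s≤s z≤n
digitsVal<3^length (i ∷ I) = subst (_< 3 ^ suc (length I)) (sym (digitsVal-∷ i I)) (begin-strict
  toℕ i * P + digitsVal I      <⟨ +-monoʳ-< (toℕ i * P) (digitsVal<3^length I) ⟩
  toℕ i * P + P                ≤⟨ +-monoˡ-≤ P (*-monoˡ-≤ P (≤-pred (toℕ<n i))) ⟩
  2 * P + P                    ≤⟨ ≤-reflexive (+-comm (2 * P) P) ⟩
  3 ^ suc (length I)           ∎≤)
  where
  open ≤-Reasoning using (begin-strict_; step-<; step-≤) renaming (_∎ to _∎≤)
  P : ℕ
  P = 3 ^ length I

radix-injective : ∀ B {a a′ b b′} → b < B → b′ < B → a * B + b ≡ a′ * B + b′ → a ≡ a′ × b ≡ b′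
radix-injective B {zero} {zero} _ _ b≡b′ = refl , b≡b′
radix-injective B {zero} {suc a′} {b′ = b′} b<B _ eq =
  ⊥-elim (<⇒≱ b<B (subst (B ≤_) (sym eq) (≤-trans (m≤m+n B (a′ * B)) (m≤m+n _ b′))))
radix-injective B {suc a} {zero} {b} _ b′<B eq =
  ⊥-elim (<⇒≱ b′<B (subst (B ≤_) eq (≤-trans (m≤m+n B (a * B)) (m≤m+n _ b))))
radix-injective B {suc a} {suc a′} {b} {b′} b<B b′<B eq with radix-injective B b<B b′<B
  (+-cancelˡ-≡ B _ _ (trans (sym (+-assoc B (a * B) b)) (trans eq (+-assoc B (a′ * B) b′))))
... | a≡a′ , b≡b′ = cong suc a≡a′ , b≡b′

digitsVal-injective : ∀ I I′ → length I ≡ length I′ → digitsVal I ≡ digitsVal I′ → I ≡ I′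
digitsVal-injective [] [] _ _ = refl
digitsVal-injective (i ∷ I) (i′ ∷ I′) |iI|≡ dv≡ with radix-injective (3 ^ length I)
    (digitsVal<3^length I) (subst (λ e → digitsVal I′ < 3 ^ e) (sym |I|≡) (digitsVal<3^length I′)) leading
  where
  |I|≡ : length I ≡ length I′
  |I|≡ = suc-injective |iI|≡
  leading : toℕ i * 3 ^ length I + digitsVal I ≡ toℕ i′ * 3 ^ length I + digitsVal I′
  leading = begin
    toℕ i * 3 ^ length I + digitsVal I     ≡⟨ digitsVal-∷ i I ⟨
    digitsVal (i ∷ I)                      ≡⟨ dv≡ ⟩
    digitsVal (i′ ∷ I′)                    ≡⟨ digitsVal-∷ i′ I′ ⟩
    toℕ i′ * 3 ^ length I′ + digitsVal I′  ≡⟨ cong (λ e → toℕ i′ * 3 ^ e + digitsVal I′) (sym |I|≡) ⟩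
    toℕ i′ * 3 ^ length I + digitsVal I′   ∎
... | i≡i′ , dvI≡ = cong₂ _∷_ (toℕ-injective i≡i′) (digitsVal-injective I I′ (suc-injective |iI|≡) dvI≡)

-- sternIndex I k − 1 lies in the block starting at blockStart |I|, at the offset whose base-3 digits are I ∷ʳ k
sternIndex≡ : ∀ I k → sternIndex I k ≡ suc (blockStart (length I) + digitsVal (I ∷ʳ k))
sternIndex≡ I k = begin
  (3 * (3 ^ length I ∸ 1)) / 2 + 3 * digitsVal I + suc (toℕ k)
    ≡⟨ cong (λ e → e + 3 * digitsVal I + suc (toℕ k)) (blockStart-closedForm (length I)) ⟩
  blockStart (length I) + 3 * digitsVal I + suc (toℕ k)
    ≡⟨ regroup (blockStart (length I)) (digitsVal I) (toℕ k) ⟩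
  suc (blockStart (length I) + (3 * digitsVal I + toℕ k))
    ≡⟨ cong (λ e → suc (blockStart (length I) + e)) (digitsVal-∷ʳ I k) ⟨
  suc (blockStart (length I) + digitsVal (I ∷ʳ k))
    ∎
  where
  regroup : ∀ (b d k : ℕ) → b + 3 * d + suc k ≡ suc (b + (3 * d + k))
  regroup = solve-∀

sternIndex->blockStart : ∀ I k → blockStart (length I) < sternIndex I k
sternIndex->blockStart I k = subst (blockStart (length I) <_) (sym (sternIndex≡ I k)) (s≤s (m≤m+n _ _))

sternIndex-≤blockStart : ∀ I k → sternIndex I k ≤ blockStart (suc (length I))
sternIndex-≤blockStart I k =
  ≤-trans (≤-reflexive (trans (sternIndex≡ I k) (sym (+-suc (blockStart (length I)) (digitsVal (I ∷ʳ k))))))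
          (+-monoʳ-≤ (blockStart (length I)) (subst (λ e → digitsVal (I ∷ʳ k) < 3 ^ e) (length-∷ʳ I k) (digitsVal<3^length (I ∷ʳ k))))

sternIndex-length : ∀ I k I′ k′ → sternIndex I k ≡ sternIndex I′ k′ → length I ≡ length I′
sternIndex-length I k I′ k′ eq with <-cmp (length I) (length I′)
... | tri≈ _ |I|≡ _ = |I|≡
... | tri< |I|<|I′| _ _ = ⊥-elim (<⇒≱ (sternIndex->blockStart I′ k′)
  (subst (_≤ blockStart (length I′)) eq (≤-trans (sternIndex-≤blockStart I k) (blockStart-mono |I|<|I′|))))
... | tri> _ _ |I′|<|I| = ⊥-elim (<⇒≱ (sternIndex->blockStart I k)
  (subst (_≤ blockStart (length I)) (sym eq) (≤-trans (sternIndex-≤blockStart I′ k′) (blockStart-mono |I′|<|I|))))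

sternIndex-injective : ∀ I k I′ k′ → sternIndex I k ≡ sternIndex I′ k′ → I ≡ I′ × k ≡ k′
sternIndex-injective I k I′ k′ eq = ∷ʳ-injective I I′ (digitsVal-injective (I ∷ʳ k) (I′ ∷ʳ k′) |Ik|≡ digits≡)
  where
  |I|≡ : length I ≡ length I′
  |I|≡ = sternIndex-length I k I′ k′ eq
  |Ik|≡ : length (I ∷ʳ k) ≡ length (I′ ∷ʳ k′)
  |Ik|≡ = trans (length-∷ʳ I k) (trans (cong suc |I|≡) (sym (length-∷ʳ I′ k′)))
  digits≡ : digitsVal (I ∷ʳ k) ≡ digitsVal (I′ ∷ʳ k′)
  digits≡ = +-cancelˡ-≡ (blockStart (length I)) _ _ (suc-injective (begin
    suc (blockStart (length I) + digitsVal (I ∷ʳ k))    ≡⟨ sternIndex≡ I k ⟨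
    sternIndex I k                                      ≡⟨ eq ⟩
    sternIndex I′ k′                                    ≡⟨ sternIndex≡ I′ k′ ⟩
    suc (blockStart (length I′) + digitsVal (I′ ∷ʳ k′)) ≡⟨ cong (λ e → suc (blockStart e + digitsVal (I′ ∷ʳ k′))) (sym |I|≡) ⟩
    suc (blockStart (length I) + digitsVal (I′ ∷ʳ k′))  ∎))

blockDecomposition : ∀ n → ∃ λ K → ∃ λ r → n ≡ blockStart K + r × r < 3 ^ suc K
blockDecomposition zero = 0 , 0 , refl , s≤s z≤n
blockDecomposition (suc n) with blockDecomposition n
... | K , r , n≡ , r< with m≤n⇒m<n∨m≡n r<
...   | inj₁ 1+r< = K , suc r , trans (cong suc n≡) (sym (+-suc (blockStart K) r)) , 1+r<
...   | inj₂ 1+r≡ = suc K , 0 , nextBlock , m^n>0 3 (suc (suc K))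
  where
  nextBlock : suc n ≡ blockStart (suc K) + 0
  nextBlock = begin
    suc n                        ≡⟨ cong suc n≡ ⟩
    suc (blockStart K + r)       ≡⟨ +-suc (blockStart K) r ⟨
    blockStart K + suc r         ≡⟨ cong (blockStart K +_) 1+r≡ ⟩
    blockStart (suc K)           ≡⟨ +-identityʳ _ ⟨
    blockStart (suc K) + 0       ∎

lastDigit : ℕ → Fin 3
lastDigit d = fromℕ< (m%n<n d 3)

digitsVal-divMod3 : ∀ I d → digitsVal I ≡ d / 3 → digitsVal (I ∷ʳ lastDigit d) ≡ d
digitsVal-divMod3 I d dvI≡ = begin
  digitsVal (I ∷ʳ lastDigit d)  ≡⟨ digitsVal-∷ʳ I (lastDigit d) ⟩
  3 * digitsVal I + toℕ (lastDigit d) ≡⟨ cong₂ (λ a b → 3 * a + b) dvI≡ (toℕ-fromℕ< (m%n<n d 3)) ⟩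
  3 * (d / 3) + d % 3           ≡⟨ trans (+-comm _ (d % 3)) (cong (d % 3 +_) (*-comm 3 (d / 3))) ⟩
  d % 3 + d / 3 * 3             ≡⟨ m≡m%n+[m/n]*n d 3 ⟨
  d                             ∎

quotient3< : ∀ K d → d < 3 ^ suc K → d / 3 < 3 ^ K
quotient3< K d d< = m<n*o⇒m/o<n (subst (d <_) (*-comm 3 (3 ^ K)) d<)

base3 : ∀ K d → d < 3 ^ K → ∃ λ I → length I ≡ K × digitsVal I ≡ d
base3 zero zero _ = [] , refl , refl
base3 zero (suc d) (s≤s ())
base3 (suc K) d d< with base3 K (d / 3) (quotient3< K d d<)
... | I , |I|≡K , dvI≡ = I ∷ʳ lastDigit d , trans (length-∷ʳ I (lastDigit d)) (cong suc |I|≡K) , digitsVal-divMod3 I d dvI≡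

sternIndex-surjective : ∀ n → ∃ λ I → ∃ λ k → sternIndex I k ≡ suc n
sternIndex-surjective n with blockDecomposition n
... | K , r , n≡ , r< with base3 K (r / 3) (quotient3< K r r<)
...   | I , refl , dvI≡ = I , lastDigit r , (begin
  sternIndex I (lastDigit r)                                ≡⟨ sternIndex≡ I (lastDigit r) ⟩
  suc (blockStart (length I) + digitsVal (I ∷ʳ lastDigit r)) ≡⟨ cong (λ e → suc (blockStart (length I) + e)) (digitsVal-divMod3 I r dvI≡) ⟩
  suc (blockStart (length I) + r)                           ≡⟨ cong suc n≡ ⟨
  suc n                                                     ∎)

sternSum-single : ∀ N (v : List (Fin 3) → Fin 3 → ℕ) I₀ k₀ → sternIndex I₀ k₀ ≡ N →
                  sum3 (λ l → sumWords≤ N (λ I → δ (sternIndex I l) N * v I l)) ≡ v I₀ k₀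
sternSum-single N v I₀ k₀ hit = begin
  sum3 (λ l → sumWords≤ N (λ I → δ (sternIndex I l) N * v I l))
    ≡⟨ sum3-single _ k₀ (λ l l≢k₀ → sumWords≤-zero N _ (λ I _ → miss I l (l≢k₀ ∘ proj₂))) ⟩
  sumWords≤ N (λ I → δ (sternIndex I k₀) N * v I k₀)
    ≡⟨ sumWords≤-single N _ I₀ |I₀|≤N (λ I _ I≢I₀ → miss I k₀ (I≢I₀ ∘ proj₁)) ⟩
  δ (sternIndex I₀ k₀) N * v I₀ k₀
    ≡⟨ trans (cong (_* v I₀ k₀) (δ-≡ hit)) (*-identityˡ _) ⟩
  v I₀ k₀
    ∎
  where
  miss : ∀ I l → ¬ (I ≡ I₀ × l ≡ k₀) → δ (sternIndex I l) N * v I l ≡ 0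
  miss I l ≢ = cong (_* v I l) (δ-≢ (λ eq → ≢ (sternIndex-injective I l I₀ k₀ (trans eq (sym hit)))))
  |I₀|≤N : length I₀ ≤ N
  |I₀|≤N = ≤-trans (blockStart-≥ (length I₀)) (<⇒≤ (subst (blockStart (length I₀) <_) hit (sternIndex->blockStart I₀ k₀)))

genSeries-coeff : ∀ a → IsSternTriatomic a → ∀ N → genSeries a N ≡ sum3 (λ l → sumWords≤ N (λ I → δ (sternIndex I l) N * vI I l))
genSeries-coeff a isStern zero = refl
genSeries-coeff a isStern (suc n) with sternIndex-surjective n
... | I₀ , k₀ , hit = begin
  a (suc n)             ≡⟨ cong a hit ⟨
  a (sternIndex I₀ k₀)  ≡⟨ isStern I₀ k₀ ⟩
  vI I₀ k₀              ≡⟨ sternSum-single (suc n) vI I₀ k₀ hit ⟨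
  sum3 (λ l → sumWords≤ (suc n) (λ I → δ (sternIndex I l) (suc n) * vI I l))
    ∎

mainTheorem1 : ∀ (a : ℕ → ℕ) → IsSternTriatomic a → ∃ λ S → HasSum S × (∀ (n : ℕ) → genSeries a n ≡ rhsSeries S n)
mainTheorem1 a isStern = limit , limit-hasSum , λ N → trans (genSeries-coeff a isStern N) (sym (rhsSeries-coeff N))
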